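{- For all integers $n,m\ge0$, let $\underline{n}:=\bigcup_{x\in T_n}x=T_n$ be the total grove of degree $n$. Then $\underline{n}+\underline{m}=\underline{n+m}$, i.e. the multiset union of the groves $x+y$ over $x\in T_n$, $y\in T_m$ is $T_{n+m}$ with every tree occurring exactly once.
   Context: A planar tree of degree $n\ge0$ is a planar rooted tree (up to planar isotopy) with $n+1$ leaves in which every internal vertex has at least two inputs; $T_n$ is the set of these trees, $T_0=\{|\}$. For trees $x^{(0)},\dots,x^{(k)}$ ($k\ge1$), the grafting $x^{(0)}\vee\cdots\vee x^{(k)}$ joins their roots (in this order) to a new vertex carrying a new root; every tree $x$ of positive degree decomposes uniquely as $x=x^{(0)}\vee\cdots\vee x^{(k)}$ with $k\ge1$. Grafting involving groves is done elementwise; a grove is a nonempty subset of some $T_n$, and operations on groves are extended from trees by distributivity (union over pairs, counted with multiplicity). The sum is defined recursively: $|+x=x+|=x$, and for $x=x^{(0)}\vee\cdots\vee x^{(k)}$, $y=y^{(0)}\vee\cdots\vee y^{(\ell)}$ of positive degree, $x+y:=x^{(0)}\vee\cdots\vee x^{(k-1)}\vee(x^{(k)}+y)\ \cup\ x^{(0)}\vee\cdots\vee x^{(k-1)}\vee(x^{(k)}+y^{(0)})\vee y^{(1)}\vee\cdots\vee y^{(\ell)}\ \cup\ (x+y^{(0)})\vee y^{(1)}\vee\cdots\vee y^{(\ell)}$. -}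

module Defs where

open import Data.Nat using (ℕ; zero; suc; _+_)
open import Data.List using (List; []; _∷_; _++_; length; map; concatMap; lookup)
open import Data.Fin using (Fin)
open import Data.Product using (_×_; ∃)
open import Relation.Binary.PropositionalEquality using (_≡_)

-- Planar rooted trees in which every internal vertex has at least two inputs.
-- A vertex with ordered inputs c₀, c₁, …, c_k (k ≥ 1) is written
--   node c₀ [c₁, …, c_{k-1}] c_k
-- i.e. first input, list of middle inputs, last input.
-- So  node a ms b  is the grafting  a ∨ m₁ ∨ ⋯ ∨ m_j ∨ b.
data Tree : Set where
  leaf : Tree
  node : Tree → List Tree → Tree → Tree

-- degree = (number of leaves) - 1
mutual
  degree : Tree → ℕ
  degree leaf = 0
  degree (node a ms b) = degree a + degrees ms + degree b + suc (length ms)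

  degrees : List Tree → ℕ
  degrees [] = 0
  degrees (t ∷ ts) = degree t + degrees ts

-- A grove with multiplicities (a multiset of trees) is represented by a list.
-- The sum x + y of two trees, following the recursive definition.
_⊕_ : Tree → Tree → List Tree
leaf ⊕ y = y ∷ []
node x₀ mx xk ⊕ leaf = node x₀ mx xk ∷ []
node x₀ mx xk ⊕ node y₀ my yl =
     map (λ z → node x₀ mx z) (xk ⊕ node y₀ my yl)
  ++ map (λ z → node x₀ (mx ++ (z ∷ my)) yl) (xk ⊕ y₀)
  ++ map (λ z → node z my yl) (node x₀ mx xk ⊕ y₀)

_⊕G_ : List Tree → List Tree → List Tree
X ⊕G Y = concatMap (λ x → concatMap (λ y → x ⊕ y) Y) X

ExactlyOnce : Tree → List Tree → Set
ExactlyOnce t L =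
  ∃ (λ (i : Fin (length L)) → lookup L i ≡ t) ×
  (∀ (i j : Fin (length L)) → lookup L i ≡ t → lookup L j ≡ t → i ≡ j)

IsTotalGrove : ℕ → List Tree → Set
IsTotalGrove n L =
  (∀ (i : Fin (length L)) → degree (lookup L i) ≡ n) ×
  (∀ (t : Tree) → degree t ≡ n → ExactlyOnce t L)

-- Every tree of x ⊕ y has degree |x| + |y|, and x ⊕ y repeats no tree: each of its three
-- branches grafts injectively, and the branches are told apart by the first child or by
-- the number of children. Conversely, a tree t of degree n + m lies in x ⊕ y for exactly one
-- pair with |x| = n. Such a pair is found by walking along the children of t to the one
-- containing the cut after degree n; it is unique because degrees force the branch: the
-- first child of t has degree < |x| except in the third branch, and the child receiving the
-- junction is where the accumulated degree of the preceding children passes |x|.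

module Submission where

open import Defs
open import Data.Nat using (ℕ; zero; suc; _+_; _≤_; _<_; z≤n; s≤s; _≤?_)
open import Data.Nat.Properties
  using ( +-assoc; +-comm; +-suc; +-identityʳ; +-cancelˡ-≡; +-cancelˡ-≤; +-cancelˡ-<
        ; +-monoʳ-≤; +-monoʳ-<; m≤m+n; <⇒≢; <⇒≱; ≰⇒>; m<1+n⇒m≤n; m≤n⇒∃[o]m+o≡n; module ≤-Reasoning)
open import Data.Nat.Tactic.RingSolver using (solve-∀)
open import Data.List using (List; []; _∷_; _++_; [_]; length; map; concatMap; lookup)
open import Data.List.Properties
  using (length-++; ++-assoc; ++-identityʳ; ++-cancelˡ; ++-identityʳ-unique; ∷-injective; ∷-injectiveˡ)
open import Data.List.Membership.Propositional using (_∈_; _∉_; find; lose)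
open import Data.List.Membership.Propositional.Properties
  using (∈-++⁺ˡ; ∈-++⁺ʳ; ∈-++⁻; ∈-map⁺; ∈-map⁻; ∈-lookup; ∈-concatMap⁺; ∈-concatMap⁻)
import Data.List.Relation.Unary.All as All
open import Data.List.Relation.Unary.Any using (here; there; index)
open import Data.List.Relation.Unary.Any.Properties using (lookup-index)
open import Data.List.Relation.Unary.AllPairs using ([]; _∷_)
open import Data.List.Relation.Unary.Unique.Propositional using (Unique)
import Data.List.Relation.Unary.Unique.Propositional.Properties as Unique
open import Data.List.Relation.Binary.Disjoint.Propositional using (Disjoint)
open import Data.Fin using () renaming (zero to fzero; suc to fsuc)
import Data.Fin.Properties as Fin
open import Data.Product using (∃₂; _×_; _,_; proj₁; proj₂)
open import Data.Sum using (inj₁; inj₂)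
open import Data.Empty using (⊥-elim)
open import Function using (_∘_)
open import Relation.Nullary using (yes; no)
open import Relation.Binary.PropositionalEquality
  using (_≡_; _≢_; refl; sym; trans; cong; cong₂; subst; subst₂; module ≡-Reasoning)

degrees-++ : ∀ ms ns → degrees (ms ++ ns) ≡ degrees ms + degrees ns
degrees-++ []       ns = refl
degrees-++ (t ∷ ms) ns = trans (cong (degree t +_) (degrees-++ ms ns)) (sym (+-assoc (degree t) _ _))

degree-first : ∀ a ms b → degree (node a ms b) ≡ degree a + degree (node leaf ms b)
degree-first a ms b = lemma (degree a) (degrees ms) (degree b) (length ms)
  where
  lemma : ∀ a s b l → a + s + b + suc l ≡ a + (s + b + suc l)
  lemma = solve-∀

degree-last : ∀ a ms b → degree (node a ms b) ≡ degree (node a ms leaf) + degree b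
degree-last a ms b = lemma (degree a) (degrees ms) (degree b) (length ms)
  where
  lemma : ∀ a s b l → a + s + b + suc l ≡ a + s + 0 + suc l + b
  lemma = solve-∀

degree-middle : ∀ a ms z ns b →
  degree (node a (ms ++ z ∷ ns) b) ≡ degree (node a ms z) + degree (node leaf ns b)
degree-middle a ms z ns b
  rewrite degrees-++ ms (z ∷ ns) | length-++ ms {z ∷ ns} =
  lemma (degree a) (degrees ms) (degree z) (degrees ns) (degree b) (length ms) (length ns)
  where
  lemma : ∀ a s z r b l k →
    a + (s + (z + r)) + b + suc (l + suc k) ≡ a + s + z + suc l + (r + b + suc k)
  lemma = solve-∀

0<degree-node : ∀ a ms b → 0 < degree (node a ms b)
0<degree-node a ms b = subst (0 <_) (sym (+-suc _ (length ms))) (s≤s z≤n)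

degree≡0⇒leaf : ∀ {t} → degree t ≡ 0 → t ≡ leaf
degree≡0⇒leaf {leaf}         _ = refl
degree≡0⇒leaf {node a ms b} d = ⊥-elim (<⇒≢ (0<degree-node a ms b) (sym d))

degree-first-child< : ∀ a ms b → degree a < degree (node a ms b)
degree-first-child< a ms b = begin-strict
  degree a                              ≡⟨ +-identityʳ (degree a) ⟨
  degree a + 0                          <⟨ +-monoʳ-< (degree a) (0<degree-node leaf ms b) ⟩
  degree a + degree (node leaf ms b)    ≡⟨ degree-first a ms b ⟨
  degree (node a ms b)                  ∎
  where open ≤-Reasoning

degree-truncation< : ∀ a ms {c z} r b → degree c ≤ degree z →
  degree (node a ms c) < degree (node a (ms ++ z ∷ r) b)
degree-truncation< a ms {c} {z} r b c≤z = begin-strict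
  degree (node a ms c)                                ≡⟨ degree-last a ms c ⟩
  degree (node a ms leaf) + degree c                  ≤⟨ +-monoʳ-≤ _ c≤z ⟩
  degree (node a ms leaf) + degree z                  ≡⟨ degree-last a ms z ⟨
  degree (node a ms z)                                ≡⟨ +-identityʳ _ ⟨
  degree (node a ms z) + 0                            <⟨ +-monoʳ-< _ (0<degree-node leaf r b) ⟩
  degree (node a ms z) + degree (node leaf r b)       ≡⟨ degree-middle a ms z r b ⟨
  degree (node a (ms ++ z ∷ r) b)                     ∎
  where open ≤-Reasoning

⊕-Step : (Tree → Tree → Set) → Set
⊕-Step P = ∀ x₀ mx xk y₀ my yl →
  P xk (node y₀ my yl) → P xk y₀ → P (node x₀ mx xk) y₀ → P (node x₀ mx xk) (node y₀ my yl)

⊕-induction : (P : Tree → Tree → Set) →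
  (∀ y → P leaf y) → (∀ x₀ mx xk → P (node x₀ mx xk) leaf) → ⊕-Step P → ∀ x y → P x y
⊕-induction P leafˡ leafʳ step = go
  where
  go : ∀ x y → P x y
  go leaf              y                 = leafˡ y
  go (node x₀ mx xk)   leaf              = leafʳ x₀ mx xk
  go (node x₀ mx xk)   (node y₀ my yl)   =
    step x₀ mx xk y₀ my yl (go xk (node y₀ my yl)) (go xk y₀) (go (node x₀ mx xk) y₀)

-- The three unions of the recursive definition of x + y, named by where the junction of
-- x and y lands among the children of t.
data ⊕-View (x₀ : Tree) (mx : List Tree) (xk y₀ : Tree) (my : List Tree) (yl t : Tree) : Set where
  via-last   : ∀ {z} → z ∈ xk ⊕ node y₀ my yl → t ≡ node x₀ mx z → ⊕-View x₀ mx xk y₀ my yl t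
  via-middle : ∀ {z} → z ∈ xk ⊕ y₀ → t ≡ node x₀ (mx ++ z ∷ my) yl → ⊕-View x₀ mx xk y₀ my yl t
  via-first  : ∀ {z} → z ∈ node x₀ mx xk ⊕ y₀ → t ≡ node z my yl → ⊕-View x₀ mx xk y₀ my yl t

⊕-view : ∀ x₀ mx xk y₀ my yl {t} →
  t ∈ node x₀ mx xk ⊕ node y₀ my yl → ⊕-View x₀ mx xk y₀ my yl t
⊕-view x₀ mx xk y₀ my yl t∈
  with ∈-++⁻ (map (node x₀ mx) (xk ⊕ node y₀ my yl)) t∈
... | inj₁ t∈₁ = let _ , z∈ , eq = ∈-map⁻ _ t∈₁ in via-last z∈ eq
... | inj₂ t∈₂ with ∈-++⁻ (map (λ z → node x₀ (mx ++ z ∷ my) yl) (xk ⊕ y₀)) t∈₂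
...   | inj₁ t∈₂′ = let _ , z∈ , eq = ∈-map⁻ _ t∈₂′ in via-middle z∈ eq
...   | inj₂ t∈₃ = let _ , z∈ , eq = ∈-map⁻ _ t∈₃ in via-first z∈ eq

∈-⊕-leaf : ∀ {t} x → t ∈ x ⊕ leaf → t ≡ x
∈-⊕-leaf leaf         (here eq) = eq
∈-⊕-leaf (node _ _ _) (here eq) = eq

∈-⊕-last : ∀ {z} x₀ mx xk y → z ∈ xk ⊕ y → node x₀ mx z ∈ node x₀ mx xk ⊕ y
∈-⊕-last x₀ mx xk leaf z∈ rewrite ∈-⊕-leaf xk z∈ = here refl
∈-⊕-last x₀ mx xk (node _ _ _) z∈ = ∈-++⁺ˡ (∈-map⁺ _ z∈)

∈-⊕-middle : ∀ {z} x₀ mx xk y₀ my yl → z ∈ xk ⊕ y₀ →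
  node x₀ (mx ++ z ∷ my) yl ∈ node x₀ mx xk ⊕ node y₀ my yl
∈-⊕-middle x₀ mx xk y₀ my yl z∈ = ∈-++⁺ʳ (map (node x₀ mx) (xk ⊕ node y₀ my yl)) (∈-++⁺ˡ (∈-map⁺ _ z∈))

∈-⊕-first : ∀ {z} x y₀ my yl → z ∈ x ⊕ y₀ → node z my yl ∈ x ⊕ node y₀ my yl
∈-⊕-first leaf y₀ my yl (here refl) = here refl
∈-⊕-first (node x₀ mx xk) y₀ my yl z∈ =
  ∈-++⁺ʳ (map (node x₀ mx) (xk ⊕ node y₀ my yl))
    (∈-++⁺ʳ (map (λ z → node x₀ (mx ++ z ∷ my) yl) (xk ⊕ y₀)) (∈-map⁺ _ z∈))


degree-⊕ : ∀ x y {t} → t ∈ x ⊕ y → degree t ≡ degree x + degree y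
degree-⊕ = ⊕-induction (λ x y → ∀ {t} → t ∈ x ⊕ y → degree t ≡ degree x + degree y)
  (λ { y (here refl) → refl })
  (λ { x₀ mx xk (here refl) → sym (+-identityʳ _) })
  step
  where
  open ≡-Reasoning
  step : ⊕-Step (λ x y → ∀ {t} → t ∈ x ⊕ y → degree t ≡ degree x + degree y)
  step x₀ mx xk y₀ my yl ih-last ih-middle ih-first t∈ with ⊕-view x₀ mx xk y₀ my yl t∈
  ... | via-last {z} z∈ refl = begin
    degree (node x₀ mx z)                  ≡⟨ degree-last x₀ mx z ⟩
    degree L + degree z                    ≡⟨ cong (degree L +_) (ih-last z∈) ⟩
    degree L + (degree xk + degree Y)      ≡⟨ +-assoc (degree L) (degree xk) (degree Y) ⟨
    degree L + degree xk + degree Y        ≡⟨ cong (_+ degree Y) (degree-last x₀ mx xk) ⟨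
    degree X + degree Y                    ∎
    where X = node x₀ mx xk; Y = node y₀ my yl; L = node x₀ mx leaf
  ... | via-middle {z} z∈ refl = begin
    degree (node x₀ (mx ++ z ∷ my) yl)                  ≡⟨ degree-middle x₀ mx z my yl ⟩
    degree (node x₀ mx z) + degree R                    ≡⟨ cong (_+ degree R) (degree-last x₀ mx z) ⟩
    degree L + degree z + degree R                      ≡⟨ cong (λ d → degree L + d + degree R) (ih-middle z∈) ⟩
    degree L + (degree xk + degree y₀) + degree R       ≡⟨ regroup (degree L) (degree xk) (degree y₀) (degree R) ⟩
    (degree L + degree xk) + (degree y₀ + degree R)     ≡⟨ cong₂ _+_ (degree-last x₀ mx xk) (degree-first y₀ my yl) ⟨
    degree (node x₀ mx xk) + degree (node y₀ my yl)     ∎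
    where
    L = node x₀ mx leaf
    R = node leaf my yl
    regroup : ∀ a b c d → a + (b + c) + d ≡ (a + b) + (c + d)
    regroup = solve-∀
  ... | via-first {z} z∈ refl = begin
    degree (node z my yl)                  ≡⟨ degree-first z my yl ⟩
    degree z + degree R                    ≡⟨ cong (_+ degree R) (ih-first z∈) ⟩
    degree X + degree y₀ + degree R        ≡⟨ +-assoc (degree X) (degree y₀) (degree R) ⟩
    degree X + (degree y₀ + degree R)      ≡⟨ cong (degree X +_) (degree-first y₀ my yl) ⟨
    degree X + degree (node y₀ my yl)      ∎
    where X = node x₀ mx xk; R = node leaf my yl

degree-≤-⊕ : ∀ x y {t} → t ∈ x ⊕ y → degree x ≤ degree t
degree-≤-⊕ x y t∈ = subst (degree x ≤_) (sym (degree-⊕ x y t∈)) (m≤m+n (degree x) (degree y))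

∉-⊕-of-smaller-degree : ∀ x y {t} → degree t < degree x → t ∉ x ⊕ y
∉-⊕-of-smaller-degree x y t<x t∈ = <⇒≱ t<x (degree-≤-⊕ x y t∈)

degree-cons : ∀ c cs b → degree (node leaf (c ∷ cs) b) ≡ suc (degree c) + degree (node leaf cs b)
degree-cons c cs b =
  trans (degree-middle leaf [] c cs b) (cong (_+ degree (node leaf cs b)) (+-comm (degree c) 1))

degree-snoc : ∀ a ms c → degree (node a (ms ++ [ c ]) leaf) ≡ degree (node a ms leaf) + suc (degree c)
degree-snoc a ms c = begin
  degree (node a (ms ++ [ c ]) leaf)          ≡⟨ degree-middle a ms c [] leaf ⟩
  degree (node a ms c) + 1                    ≡⟨ cong (_+ 1) (degree-last a ms c) ⟩
  degree (node a ms leaf) + degree c + 1      ≡⟨ +-assoc (degree (node a ms leaf)) (degree c) 1 ⟩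
  degree (node a ms leaf) + (degree c + 1)    ≡⟨ cong (degree (node a ms leaf) +_) (+-comm (degree c) 1) ⟩
  degree (node a ms leaf) + suc (degree c)    ∎
  where open ≡-Reasoning

record Split (t : Tree) (n : ℕ) : Set where
  constructor split
  field
    left right  : Tree
    left-degree : degree left ≡ n
    ∈-⊕         : t ∈ left ⊕ right

degree-right : ∀ {t n m} (s : Split t n) → degree t ≡ n + m → degree (Split.right s) ≡ m
degree-right {n = n} {m} (split left right left-degree t∈) t-degree =
  +-cancelˡ-≡ n (degree right) m
    (trans (cong (_+ degree right) (sym left-degree)) (trans (sym (degree-⊕ left right t∈)) t-degree))

mutual
  split-exists : ∀ t n → n ≤ degree t → Split t n
  split-exists leaf zero _ = split leaf leaf refl (here refl)
  split-exists (node c₀ cs cK) n n≤t with n ≤? degree c₀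
  ... | yes n≤c₀ =
    let split x y₀ x-degree c₀∈ = split-exists c₀ n n≤c₀
    in split x (node y₀ cs cK) x-degree (∈-⊕-first x y₀ cs cK c₀∈)
  ... | no n≰c₀ with m≤n⇒∃[o]m+o≡n (≰⇒> n≰c₀)
  ...   | k , refl =
    subst (Split (node c₀ cs cK)) (cong (_+ k) (degree-singleton c₀)) (split-children c₀ [] cs cK k k<)
    where
    degree-singleton : ∀ a → degree (node a [] leaf) ≡ suc (degree a)
    degree-singleton a = lemma (degree a)
      where
      lemma : ∀ a → a + 0 + 0 + 1 ≡ suc a
      lemma = solve-∀
    k< : k < degree (node leaf cs cK)
    k< = +-cancelˡ-≤ (degree c₀) (suc k) (degree (node leaf cs cK))
      (subst₂ _≤_ (sym (+-suc (degree c₀) k)) (degree-first c₀ cs cK) n≤t)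

  -- The cut lies n past the subtree formed by the children x₀ ∷ pre already passed.
  split-children : ∀ x₀ pre cs cK n → n < degree (node leaf cs cK) →
    Split (node x₀ (pre ++ cs) cK) (degree (node x₀ pre leaf) + n)
  split-children x₀ pre [] cK n n< rewrite ++-identityʳ pre =
    let split xk y xk-degree cK∈ = split-exists cK n (m<1+n⇒m≤n (subst (n <_) (+-comm (degree cK) 1) n<))
    in split (node x₀ pre xk) y (trans (degree-last x₀ pre xk) (cong (_ +_) xk-degree))
         (∈-⊕-last x₀ pre xk y cK∈)
  split-children x₀ pre (c ∷ cs) cK n n< with n ≤? degree c
  ... | yes n≤c =
    let split xk y₀ xk-degree c∈ = split-exists c n n≤c
    in split (node x₀ pre xk) (node y₀ cs cK) (trans (degree-last x₀ pre xk) (cong (_ +_) xk-degree))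
         (∈-⊕-middle x₀ pre xk y₀ cs cK c∈)
  ... | no n≰c with m≤n⇒∃[o]m+o≡n (≰⇒> n≰c)
  ...   | k , refl =
    subst₂ Split (cong (λ ms → node x₀ ms cK) (++-assoc pre [ c ] cs))
      (trans (cong (_+ k) (degree-snoc x₀ pre c)) (+-assoc (degree (node x₀ pre leaf)) (suc (degree c)) k))
      (split-children x₀ (pre ++ [ c ]) cs cK k k<)
    where
    k< : k < degree (node leaf cs cK)
    k< = +-cancelˡ-< (suc (degree c)) k (degree (node leaf cs cK))
           (subst (suc (degree c) + k <_) (degree-cons c cs cK) n<)

node-injective : ∀ {a ms b a′ ms′ b′} → node a ms b ≡ node a′ ms′ b′ → a ≡ a′ × ms ≡ ms′ × b ≡ b′
node-injective refl = refl , refl , refl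

first-child-∉-⊕ : ∀ a ms b x y → degree (node a ms b) ≡ degree x → a ∉ x ⊕ y
first-child-∉-⊕ a ms b x y e = ∉-⊕-of-smaller-degree x y (subst (degree a <_) e (degree-first-child< a ms b))

truncation-degree-≢ : ∀ a ms c y {z} r b → z ∈ c ⊕ y →
  degree (node a ms c) ≢ degree (node a (ms ++ z ∷ r) b)
truncation-degree-≢ a ms c y r b z∈ = <⇒≢ (degree-truncation< a ms {c} r b (degree-≤-⊕ c y z∈))

degree-last-cancel : ∀ a ms b b′ → degree (node a ms b) ≡ degree (node a ms b′) → degree b ≡ degree b′
degree-last-cancel a ms b b′ e =
  +-cancelˡ-≡ (degree (node a ms leaf)) (degree b) (degree b′)
    (trans (sym (degree-last a ms b)) (trans e (degree-last a ms b′)))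

degree-right-≡ : ∀ {t} x y x′ y′ → t ∈ x ⊕ y → t ∈ x′ ⊕ y′ →
  degree x ≡ degree x′ → degree y ≡ degree y′
degree-right-≡ x y x′ y′ t∈ t∈′ e =
  +-cancelˡ-≡ (degree x) (degree y) (degree y′)
    (trans (sym (degree-⊕ x y t∈)) (trans (degree-⊕ x′ y′ t∈′) (cong (_+ degree y′) (sym e))))

data Pivots {A : Set} (mx : List A) (z : A) (my mx′ : List A) (z′ : A) (my′ : List A) : Set where
  same-pivot   : mx ≡ mx′ → z ≡ z′ → my ≡ my′ → Pivots mx z my mx′ z′ my′
  pivot-before : ∀ r → mx′ ≡ mx ++ z ∷ r → Pivots mx z my mx′ z′ my′
  pivot-after  : ∀ r → mx ≡ mx′ ++ z′ ∷ r → Pivots mx z my mx′ z′ my′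

compare-pivots : ∀ {A : Set} (mx : List A) z my mx′ z′ my′ →
  mx ++ z ∷ my ≡ mx′ ++ z′ ∷ my′ → Pivots mx z my mx′ z′ my′
compare-pivots []       z my []        z′ my′ refl = same-pivot refl refl refl
compare-pivots []       z my (w ∷ mx′) z′ my′ refl = pivot-before mx′ refl
compare-pivots (w ∷ mx) z my []        z′ my′ refl = pivot-after mx refl
compare-pivots (w ∷ mx) z my (w′ ∷ mx′) z′ my′ eq with ∷-injective eq
... | refl , eq′ with compare-pivots mx z my mx′ z′ my′ eq′
...   | same-pivot refl refl refl = same-pivot refl refl refl
...   | pivot-before r refl       = pivot-before r refl
...   | pivot-after r refl        = pivot-after r refl

⊕-split-unique : ∀ x y x′ y′ {t} → t ∈ x ⊕ y → t ∈ x′ ⊕ y′ →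
  degree x ≡ degree x′ → x ≡ x′ × y ≡ y′
⊕-split-unique = ⊕-induction SplitUnique leafˡ leafʳ step
  where
  SplitUnique : Tree → Tree → Set
  SplitUnique x y = ∀ x′ y′ {t} → t ∈ x ⊕ y → t ∈ x′ ⊕ y′ →
    degree x ≡ degree x′ → x ≡ x′ × y ≡ y′

  leafˡ : ∀ y → SplitUnique leaf y
  leafˡ y x′ y′ (here refl) t∈′ e with degree≡0⇒leaf {x′} (sym e) | t∈′
  ... | refl | here refl = refl , refl

  leafʳ : ∀ x₀ mx xk → SplitUnique (node x₀ mx xk) leaf
  leafʳ x₀ mx xk x′ y′ (here refl) t∈′ e
    with degree≡0⇒leaf {y′} (sym (degree-right-≡ (node x₀ mx xk) leaf x′ y′ (here refl) t∈′ e))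
  ... | refl = ∈-⊕-leaf x′ t∈′ , refl

  step : ⊕-Step SplitUnique
  step x₀ mx xk y₀ my yl _ _ _ leaf _ _ _ e = ⊥-elim (<⇒≢ (0<degree-node x₀ mx xk) (sym e))
  step x₀ mx xk y₀ my yl _ _ _ x′ leaf t∈ t∈′ e =
    ⊥-elim (<⇒≢ (0<degree-node y₀ my yl)
      (sym (degree-right-≡ (node x₀ mx xk) (node y₀ my yl) x′ leaf t∈ t∈′ e)))
  step x₀ mx xk y₀ my yl ih-last ih-middle ih-first (node x₀′ mx′ xk′) (node y₀′ my′ yl′) t∈ t∈′ =
    by-views (⊕-view x₀ mx xk y₀ my yl t∈) (⊕-view x₀′ mx′ xk′ y₀′ my′ yl′ t∈′)
    where
    by-views : ∀ {t} → ⊕-View x₀ mx xk y₀ my yl t → ⊕-View x₀′ mx′ xk′ y₀′ my′ yl′ t →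
      degree (node x₀ mx xk) ≡ degree (node x₀′ mx′ xk′) →
      node x₀ mx xk ≡ node x₀′ mx′ xk′ × node y₀ my yl ≡ node y₀′ my′ yl′
    by-views (via-last z∈ refl) (via-last z∈′ refl) e
      with ih-last xk′ (node y₀′ my′ yl′) z∈ z∈′ (degree-last-cancel x₀ mx xk xk′ e)
    ... | refl , refl = refl , refl
    by-views (via-last z∈ refl) (via-middle z∈′ eq) e with node-injective eq
    ... | refl , refl , _ = ⊥-elim (truncation-degree-≢ x₀ mx′ xk′ y₀′ my′ xk z∈′ (sym e))
    by-views (via-middle z∈ refl) (via-last z∈′ refl) e = ⊥-elim (truncation-degree-≢ x₀ mx xk y₀ my xk′ z∈ e)
    by-views (via-middle z∈ refl) (via-middle z∈′ eq) e with node-injective eq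
    ... | refl , eq-children , refl with compare-pivots mx _ my mx′ _ my′ eq-children
    ...   | pivot-before r refl = ⊥-elim (truncation-degree-≢ x₀ mx xk y₀ r xk′ z∈ e)
    ...   | pivot-after r refl = ⊥-elim (truncation-degree-≢ x₀ mx′ xk′ y₀′ r xk z∈′ (sym e))
    ...   | same-pivot refl refl refl
            with ih-middle xk′ y₀′ z∈ z∈′ (degree-last-cancel x₀ mx xk xk′ e)
    ...     | refl , refl = refl , refl
    by-views (via-first z∈ refl) (via-first z∈′ refl) e
      with ih-first (node x₀′ mx′ xk′) y₀′ z∈ z∈′ e
    ... | refl , refl = refl , refl
    by-views (via-last _ refl) (via-first z∈′ refl) e = ⊥-elim (first-child-∉-⊕ x₀ mx xk _ y₀′ e z∈′)
    by-views (via-middle _ refl) (via-first z∈′ refl) e = ⊥-elim (first-child-∉-⊕ x₀ mx xk _ y₀′ e z∈′)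
    by-views (via-first z∈ refl) (via-last _ refl) e = ⊥-elim (first-child-∉-⊕ x₀′ mx′ xk′ _ y₀ (sym e) z∈)
    by-views (via-first z∈ refl) (via-middle _ eq) e with node-injective eq
    ... | refl , _ , _ = ⊥-elim (first-child-∉-⊕ x₀′ mx′ xk′ _ y₀ (sym e) z∈)

map-disjoint : ∀ {A B C : Set} {f : A → C} {g : B → C} {xs ys} →
  (∀ {x y} → x ∈ xs → y ∈ ys → f x ≢ g y) → Disjoint (map f xs) (map g ys)
map-disjoint {f = f} {g} f≢g (v∈fxs , v∈gys) with ∈-map⁻ f v∈fxs | ∈-map⁻ g v∈gys
... | _ , x∈ , refl | _ , y∈ , eq = f≢g x∈ y∈ eq

disjoint-++⁺ʳ : ∀ {A : Set} {xs ys zs : List A} → Disjoint xs ys → Disjoint xs zs → Disjoint xs (ys ++ zs)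
disjoint-++⁺ʳ {ys = ys} xs#ys xs#zs (v∈xs , v∈ys++zs) with ∈-++⁻ ys v∈ys++zs
... | inj₁ v∈ys = xs#ys (v∈xs , v∈ys)
... | inj₂ v∈zs = xs#zs (v∈xs , v∈zs)

children-length-≢ : ∀ a ms c z r b → node a ms c ≢ node a (ms ++ z ∷ r) b
children-length-≢ a ms c z r b eq with ++-identityʳ-unique ms (proj₁ (proj₂ (node-injective eq)))
... | ()

⊕-unique : ∀ x y → Unique (x ⊕ y)
⊕-unique = ⊕-induction (λ x y → Unique (x ⊕ y)) (λ _ → All.[] ∷ []) (λ _ _ _ → All.[] ∷ []) step
  where
  step : ⊕-Step (λ x y → Unique (x ⊕ y))
  step x₀ mx xk y₀ my yl last! middle! first! =
    Unique.++⁺ (Unique.map⁺ (λ eq → proj₂ (proj₂ (node-injective eq))) last!)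
      (Unique.++⁺
        (Unique.map⁺ (λ eq → ∷-injectiveˡ (++-cancelˡ mx _ _ (proj₁ (proj₂ (node-injective eq))))) middle!)
        (Unique.map⁺ (λ eq → proj₁ (node-injective eq)) first!)
        (map-disjoint λ _ z∈ eq → first-child-∉ z∈ (proj₁ (node-injective eq))))
      (disjoint-++⁺ʳ (map-disjoint λ _ _ → children-length-≢ x₀ mx _ _ my yl)
        (map-disjoint λ _ z∈ eq → first-child-∉ z∈ (proj₁ (node-injective eq))))
    where
    first-child-∉ : ∀ {z} → z ∈ node x₀ mx xk ⊕ y₀ → x₀ ≢ z
    first-child-∉ z∈ refl = first-child-∉-⊕ x₀ mx xk (node x₀ mx xk) y₀ refl z∈

Unique⇒lookup-injective : ∀ {A : Set} {xs : List A} → Unique xs →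
  ∀ i j → lookup xs i ≡ lookup xs j → i ≡ j
Unique⇒lookup-injective (_  ∷ _)      fzero    fzero    _  = refl
Unique⇒lookup-injective (x∉ ∷ _)      fzero    (fsuc j) eq = ⊥-elim (All.lookup x∉ (∈-lookup j) eq)
Unique⇒lookup-injective (x∉ ∷ _)      (fsuc i) fzero    eq = ⊥-elim (All.lookup x∉ (∈-lookup i) (sym eq))
Unique⇒lookup-injective (_  ∷ xs!)    (fsuc i) (fsuc j) eq = cong fsuc (Unique⇒lookup-injective xs! i j eq)

lookup-injective⇒Unique : ∀ {A : Set} {xs : List A} →
  (∀ i j → lookup xs i ≡ lookup xs j → i ≡ j) → Unique xs
lookup-injective⇒Unique {xs = []}     _   = []
lookup-injective⇒Unique {xs = x ∷ xs} inj =
  All.tabulate (λ y∈ x≡y → Fin.0≢1+n (inj fzero (fsuc (index y∈)) (trans x≡y (lookup-index y∈))))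
  ∷ lookup-injective⇒Unique (λ i j eq → Fin.suc-injective (inj (fsuc i) (fsuc j) eq))

Unique⇒ExactlyOnce : ∀ {t L} → Unique L → t ∈ L → ExactlyOnce t L
Unique⇒ExactlyOnce L! t∈ =
  (index t∈ , sym (lookup-index t∈)) ,
  λ i j eqᵢ eqⱼ → Unique⇒lookup-injective L! i j (trans eqᵢ (sym eqⱼ))

module TotalGrove {n} (L : List Tree) (L-total : IsTotalGrove n L) where

  degree-∈ : ∀ {t} → t ∈ L → degree t ≡ n
  degree-∈ t∈ = subst (λ u → degree u ≡ n) (sym (lookup-index t∈)) (proj₁ L-total (index t∈))

  ∈-of-degree : ∀ {t} → degree t ≡ n → t ∈ L
  ∈-of-degree {t} t-degree = let (i , eq) , _ = proj₂ L-total t t-degree in subst (_∈ L) eq (∈-lookup i)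

  unique : Unique L
  unique = lookup-injective⇒Unique λ i j eq →
    proj₂ (proj₂ L-total (lookup L i) (proj₁ L-total i)) i j refl (sym eq)

concatMap-unique : ∀ {A B : Set} {f : A → List B} {xs} → Unique xs →
  (∀ {x} → x ∈ xs → Unique (f x)) →
  (∀ {x x′} → x ∈ xs → x′ ∈ xs → x ≢ x′ → Disjoint (f x) (f x′)) →
  Unique (concatMap f xs)
concatMap-unique [] _ _ = []
concatMap-unique {f = f} {x ∷ xs} (x∉ ∷ xs!) f! f# =
  Unique.++⁺ (f! (here refl))
    (concatMap-unique xs! (f! ∘ there) λ x∈ x′∈ → f# (there x∈) (there x′∈))
    fx#rest
  where
  fx#rest : Disjoint (f x) (concatMap f xs)
  fx#rest (v∈fx , v∈rest) =
    let x′ , x′∈ , v∈fx′ = find (∈-concatMap⁻ f v∈rest)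
    in f# (here refl) (there x′∈) (All.lookup x∉ x′∈) (v∈fx , v∈fx′)

∈-⊕G⁺ : ∀ {X Y t x y} → x ∈ X → y ∈ Y → t ∈ x ⊕ y → t ∈ X ⊕G Y
∈-⊕G⁺ x∈ y∈ t∈ = ∈-concatMap⁺ _ (lose x∈ (∈-concatMap⁺ _ (lose y∈ t∈)))

∈-⊕G⁻ : ∀ {X Y t} → t ∈ X ⊕G Y → ∃₂ λ x y → x ∈ X × y ∈ Y × t ∈ x ⊕ y
∈-⊕G⁻ t∈ =
  let x , x∈ , t∈x⊕Y = find (∈-concatMap⁻ _ t∈)
      y , y∈ , t∈x⊕y = find (∈-concatMap⁻ _ t∈x⊕Y)
  in x , y , x∈ , y∈ , t∈x⊕y

⊕G-unique : ∀ {n X Y} → Unique X → Unique Y → (∀ {x} → x ∈ X → degree x ≡ n) → Unique (X ⊕G Y)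
⊕G-unique {X = X} {Y} X! Y! X-degree =
  concatMap-unique {f = λ x → concatMap (x ⊕_) Y} X! (λ {x} _ → row-unique {x}) rows-disjoint
  where
  row-unique : ∀ {x} → Unique (concatMap (x ⊕_) Y)
  row-unique {x} = concatMap-unique {f = x ⊕_} Y! (λ {y} _ → ⊕-unique x y)
    λ {y} {y′} _ _ y≢y′ (t∈ , t∈′) → y≢y′ (proj₂ (⊕-split-unique x y x y′ t∈ t∈′ refl))

  rows-disjoint : ∀ {x x′} → x ∈ X → x′ ∈ X → x ≢ x′ →
    Disjoint (concatMap (x ⊕_) Y) (concatMap (x′ ⊕_) Y)
  rows-disjoint {x} {x′} x∈ x′∈ x≢x′ (t∈ , t∈′) =
    let y , _ , t∈x⊕y = find (∈-concatMap⁻ (x ⊕_) {Y} t∈)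
        y′ , _ , t∈x′⊕y′ = find (∈-concatMap⁻ (x′ ⊕_) {Y} t∈′)
    in x≢x′ (proj₁ (⊕-split-unique x y x′ y′ t∈x⊕y t∈x′⊕y′
                      (trans (X-degree x∈) (sym (X-degree x′∈)))))

proposition9p6 : (n m : ℕ) (Tn Tm : List Tree) →
    IsTotalGrove n Tn → IsTotalGrove m Tm →
    IsTotalGrove (n + m) (Tn ⊕G Tm)
proposition9p6 n m Tn Tm Tn-total Tm-total = sum-degree , exactly-once
  where
  module Gn = TotalGrove Tn Tn-total
  module Gm = TotalGrove Tm Tm-total

  sum-degree : ∀ i → degree (lookup (Tn ⊕G Tm) i) ≡ n + m
  sum-degree i =
    let x , y , x∈ , y∈ , t∈ = ∈-⊕G⁻ {Tn} {Tm} (∈-lookup i)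
    in trans (degree-⊕ x y t∈) (cong₂ _+_ (Gn.degree-∈ x∈) (Gm.degree-∈ y∈))

  exactly-once : ∀ t → degree t ≡ n + m → ExactlyOnce t (Tn ⊕G Tm)
  exactly-once t t-degree =
    Unique⇒ExactlyOnce (⊕G-unique Gn.unique Gm.unique Gn.degree-∈)
      (∈-⊕G⁺ {Tn} {Tm} (Gn.∈-of-degree {left} left-degree)
                       (Gm.∈-of-degree {right} (degree-right t-split t-degree)) ∈-⊕)
    where
    t-split : Split t n
    t-split = split-exists t n (subst (n ≤_) (sym t-degree) (m≤m+n n m))
    open Split t-split
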